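{- Let $V = L \cup R$ be a disjoint union of finite nail sets with $|L| = n_1 \ge 1$, $|R| = n_2 \ge 1$, and let $k$ be an integer with $1 \le k \le n_1 + n_2$. Call an integer $j$ feasible if $\max(0, k-n_2) \le j \le \min(k, n_1)$. For a nonempty set $J$ of feasible indices, define the specification $f_J$ on $V$ by: $f_J(S) = \mathsf{fall}$ iff there exists $j \in J$ with $|S \cap L| \ge j$ and $|S \cap R| \ge k-j$. Let $J_1, J_2$ be disjoint nonempty sets of feasible indices, and let $S \subseteq V$ be such that $f_{J_1}(S) = f_{J_2}(S) = \mathsf{hang}$. Then $f_{J_1}$ and $f_{J_2}$ separate above $S$, i.e. there exists $S' \supseteq S$ with $f_{J_1}(S') \neq f_{J_2}(S')$.
   Context: A specification on a finite nail set $V$ is a monotone function $f : 2^V \to \{\mathsf{hang},\mathsf{fall}\}$ (order $\mathsf{hang} < \mathsf{fall}$; monotone means $S \subseteq S' \Rightarrow f(S) \le f(S')$) with $f(V) = \mathsf{fall}$. -}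

module Defs where

open import Data.Nat using (ℕ; zero; suc; _+_; _∸_; _≤_; _⊔_; _⊓_)
open import Data.Nat.Properties using (_≤?_)
open import Data.Fin using (Fin; toℕ; splitAt)
open import Data.Fin.Subset using (Subset; _∩_; ∣_∣; _∈_; _⊆_; Nonempty; Empty)
open import Data.Vec using (tabulate)
open import Data.Sum using (inj₁; inj₂)
open import Data.Bool using (Bool; true; false)
open import Data.Product using (_×_; ∃-syntax)
open import Relation.Nullary using (Dec; yes; no; ¬_)
open import Relation.Nullary.Decidable using (_×-dec_)
open import Data.Fin.Subset.Properties using (_∈?_)
open import Data.Fin.Properties using (any?)

data Outcome : Set where
  hang fall : Outcome

-- The nail set V = L ⊔ R is modelled as Fin (n₁ + n₂);
-- L = the first n₁ elements, R = the last n₂ elements.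
Lset : (n₁ n₂ : ℕ) → Subset (n₁ + n₂)
Lset n₁ n₂ = tabulate λ i → isL (splitAt n₁ i)
  where
  isL : _ → Bool
  isL (inj₁ _) = true
  isL (inj₂ _) = false

Rset : (n₁ n₂ : ℕ) → Subset (n₁ + n₂)
Rset n₁ n₂ = tabulate λ i → isR (splitAt n₁ i)
  where
  isR : _ → Bool
  isR (inj₁ _) = false
  isR (inj₂ _) = true

Feasible : (n₁ n₂ k j : ℕ) → Set
Feasible n₁ n₂ k j = (k ∸ n₂) ≤ j × j ≤ (k ⊓ n₁)

-- A set J of indices is a subset of {0,…,k} (every feasible j is ≤ k),
-- represented as a Subset (suc k); index j corresponds to toℕ of an element.
-- J is a nonempty set of feasible indices:
FeasibleSet : (n₁ n₂ k : ℕ) → Subset (suc k) → Set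
FeasibleSet n₁ n₂ k J = Nonempty J × (∀ {j} → j ∈ J → Feasible n₁ n₂ k (toℕ j))

witness? : (n₁ n₂ k : ℕ) (S : Subset (n₁ + n₂)) (j : Fin (suc k)) →
           Dec (toℕ j ≤ ∣ S ∩ Lset n₁ n₂ ∣ × (k ∸ toℕ j) ≤ ∣ S ∩ Rset n₁ n₂ ∣)
witness? n₁ n₂ k S j = (toℕ j ≤? ∣ S ∩ Lset n₁ n₂ ∣) ×-dec ((k ∸ toℕ j) ≤? ∣ S ∩ Rset n₁ n₂ ∣)

Fall : (n₁ n₂ k : ℕ) → Subset (suc k) → Subset (n₁ + n₂) → Set
Fall n₁ n₂ k J S =
  ∃[ j ] (j ∈ J × toℕ j ≤ ∣ S ∩ Lset n₁ n₂ ∣ × (k ∸ toℕ j) ≤ ∣ S ∩ Rset n₁ n₂ ∣)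

Fall? : (n₁ n₂ k : ℕ) (J : Subset (suc k)) (S : Subset (n₁ + n₂)) → Dec (Fall n₁ n₂ k J S)
Fall? n₁ n₂ k J S = any? λ j → (j ∈? J) ×-dec witness? n₁ n₂ k S j

f : (n₁ n₂ k : ℕ) → Subset (suc k) → Subset (n₁ + n₂) → Outcome
f n₁ n₂ k J S with Fall? n₁ n₂ k J S
... | yes _ = fall
... | no _ = hang

-- Whether f_J falls on S depends only on a = ∣S ∩ L∣ and b = ∣S ∩ R∣. Grow S one nail at a time
-- towards V, on which f_J₁ falls. While both specifications hang, no single step can make both
-- fall: adding a nail of L makes f_J fall only through the witness j = a + 1 (adding one of R,
-- only through k ∸ j = b + 1), and the disjoint J₁, J₂ cannot share that witness. Hence the first
-- step at which one of them falls separates them.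
module Submission where

open import Defs
open import Data.Nat using (ℕ; suc; _+_; _≤_)
open import Data.Fin.Subset using (Subset; _⊆_; _∩_; Empty)
open import Data.Product using (_×_; ∃-syntax)
open import Relation.Binary.PropositionalEquality using (_≡_; _≢_)

open import Data.Nat using (_∸_)
open import Data.Nat.Properties
  using (≤-antisym; ≰⇒>; ∸-cancelˡ-≡; m≤n⊓o⇒m≤o; m≤n+o⇒m∸n≤o; m≤n+m∸n; +-monoʳ-≤; +-comm;
         +-identityʳ; m+n∸m≡n; module ≤-Reasoning)
open import Data.Fin using (Fin; zero; suc; toℕ; splitAt)
open import Data.Fin.Properties using (toℕ-injective; toℕ≤pred[n])
open import Data.Fin.Subset using (inside; outside; ⊤; ⊥; ⁅_⁆; _∪_; ∁; ∣_∣; _∈_; _∉_; _⊃_; _⊂_)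
open import Data.Fin.Subset.Properties
  using (_∈?_; nonempty?; drop-not-there; x∈⁅x⁆; x∈p∪q⁺; p⊆p∪q; ⊆-trans; ⊆-antisym; ⊆⊤;
         x∈p∩q⁺; x∈p⇒x∉∁p; x∉p⇒x∈∁p; x∉∁p⇒x∈p; x∈∁p⇒x∉p; ∪-identityʳ; ∩-identityˡ; ∣⊤∣≡n; ∣⊥∣≡0; ∣∁p∣≡n∸∣p∣)
open import Data.Fin.Subset.Induction using (Acc; acc; ⊃-wellFounded)
open import Data.Vec using (Vec; []; _∷_; here; there; lookup; _++_)
open import Data.Vec.Properties
  using (lookup∘tabulate; tabulate∘lookup; tabulate-cong; lookup-splitAt; lookup-replicate; lookup-map)
open import Data.Bool using (not)
open import Data.Sum using (_⊎_; inj₁; inj₂; [_,_]′)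
open import Data.Sum.Properties using ([,]-cong; [,]-∘)
open import Data.Product using (_,_)
open import Function using (const; _∋_)
open import Relation.Nullary using (¬_; yes; no; contradiction)
open import Relation.Unary using (Pred; Decidable)
open import Relation.Binary.PropositionalEquality using (refl; sym; trans; cong; cong₂; subst; subst₂; _≗_; module ≡-Reasoning)

lookup-≗⇒≡ : ∀ {a} {A : Set a} {n} {xs ys : Vec A n} → lookup xs ≗ lookup ys → xs ≡ ys
lookup-≗⇒≡ {xs = xs} {ys} eq =
  trans (sym (tabulate∘lookup xs)) (trans (tabulate-cong eq) (tabulate∘lookup ys))

∣p++q∣≡∣p∣+∣q∣ : ∀ {m n} (p : Subset m) (q : Subset n) → ∣ p ++ q ∣ ≡ ∣ p ∣ + ∣ q ∣
∣p++q∣≡∣p∣+∣q∣ []            q = refl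
∣p++q∣≡∣p∣+∣q∣ (outside ∷ p) q = ∣p++q∣≡∣p∣+∣q∣ p q
∣p++q∣≡∣p∣+∣q∣ (inside  ∷ p) q = cong suc (∣p++q∣≡∣p∣+∣q∣ p q)

∣p∪⁅x⁆∩q∣≡1+∣p∩q∣ : ∀ {n} {x : Fin n} (p q : Subset n) → x ∉ p → x ∈ q →
                     ∣ (p ∪ ⁅ x ⁆) ∩ q ∣ ≡ suc ∣ p ∩ q ∣
∣p∪⁅x⁆∩q∣≡1+∣p∩q∣ (inside  ∷ p) _            x∉p here = contradiction here x∉p
∣p∪⁅x⁆∩q∣≡1+∣p∩q∣ (outside ∷ p) (inside ∷ q) _   here = cong (λ r → suc ∣ r ∩ q ∣) (∪-identityʳ p)
∣p∪⁅x⁆∩q∣≡1+∣p∩q∣ (inside  ∷ p) (inside  ∷ q) x∉p (there x∈q) =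
  cong suc (∣p∪⁅x⁆∩q∣≡1+∣p∩q∣ p q (drop-not-there x∉p) x∈q)
∣p∪⁅x⁆∩q∣≡1+∣p∩q∣ (inside  ∷ p) (outside ∷ q) x∉p (there x∈q) =
  ∣p∪⁅x⁆∩q∣≡1+∣p∩q∣ p q (drop-not-there x∉p) x∈q
∣p∪⁅x⁆∩q∣≡1+∣p∩q∣ (outside ∷ p) (_       ∷ q) x∉p (there x∈q) =
  ∣p∪⁅x⁆∩q∣≡1+∣p∩q∣ p q (drop-not-there x∉p) x∈q

∣p∪⁅x⁆∩q∣≡∣p∩q∣ : ∀ {n} {x : Fin n} (p q : Subset n) → x ∉ q → ∣ (p ∪ ⁅ x ⁆) ∩ q ∣ ≡ ∣ p ∩ q ∣
∣p∪⁅x⁆∩q∣≡∣p∩q∣ {x = zero}  (_       ∷ p) (inside  ∷ q) x∉q = contradiction here x∉q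
∣p∪⁅x⁆∩q∣≡∣p∩q∣ {x = zero}  (inside  ∷ p) (outside ∷ q) _   = cong (λ r → ∣ r ∩ q ∣) (∪-identityʳ p)
∣p∪⁅x⁆∩q∣≡∣p∩q∣ {x = zero}  (outside ∷ p) (outside ∷ q) _   = cong (λ r → ∣ r ∩ q ∣) (∪-identityʳ p)
∣p∪⁅x⁆∩q∣≡∣p∩q∣ {x = suc x} (inside  ∷ p) (inside  ∷ q) x∉q =
  cong suc (∣p∪⁅x⁆∩q∣≡∣p∩q∣ p q (drop-not-there x∉q))
∣p∪⁅x⁆∩q∣≡∣p∩q∣ {x = suc x} (inside  ∷ p) (outside ∷ q) x∉q = ∣p∪⁅x⁆∩q∣≡∣p∩q∣ p q (drop-not-there x∉q)
∣p∪⁅x⁆∩q∣≡∣p∩q∣ {x = suc x} (outside ∷ p) (_       ∷ q) x∉q = ∣p∪⁅x⁆∩q∣≡∣p∩q∣ p q (drop-not-there x∉q)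

x∉p⇒p⊂p∪⁅x⁆ : ∀ {n} {x : Fin n} {p : Subset n} → x ∉ p → p ⊂ p ∪ ⁅ x ⁆
x∉p⇒p⊂p∪⁅x⁆ {x = x} x∉p = p⊆p∪q ⁅ x ⁆ , x , x∈p∪q⁺ (inj₂ (x∈⁅x⁆ x)) , x∉p

Empty[∁p]⇒p≡⊤ : ∀ {n} {p : Subset n} → Empty (∁ p) → p ≡ ⊤
Empty[∁p]⇒p≡⊤ ∁p-empty = ⊆-antisym ⊆⊤ (λ {x} _ → x∉∁p⇒x∈p (λ x∈∁p → ∁p-empty (x , x∈∁p)))

module _ {n ℓ} {P Q : Pred (Subset n) ℓ} (P? : Decidable P) (Q? : Decidable Q) (P⊤ : P ⊤)
         (¬both-∪⁅x⁆ : ∀ {S x} → x ∉ S → ¬ P S → ¬ Q S → ¬ (P (S ∪ ⁅ x ⁆) × Q (S ∪ ⁅ x ⁆)))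
         where

  separated-above : ∀ S → ¬ P S → ¬ Q S →
                    ∃[ S′ ] (S ⊆ S′ × (P S′ × ¬ Q S′ ⊎ ¬ P S′ × Q S′))
  separated-above S = go S (⊃-wellFounded S)
    where
    go : ∀ S → Acc _⊃_ S → ¬ P S → ¬ Q S → ∃[ S′ ] (S ⊆ S′ × (P S′ × ¬ Q S′ ⊎ ¬ P S′ × Q S′))
    go S (acc larger) ¬PS ¬QS with nonempty? (∁ S)
    ... | no ∁S-empty = contradiction (subst P (sym (Empty[∁p]⇒p≡⊤ ∁S-empty)) P⊤) ¬PS
    ... | yes (x , x∈∁S) with P? (S ∪ ⁅ x ⁆) | Q? (S ∪ ⁅ x ⁆)
    ...   | yes P⁺ | yes Q⁺ = contradiction (P⁺ , Q⁺) (¬both-∪⁅x⁆ (x∈∁p⇒x∉p x∈∁S) ¬PS ¬QS)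
    ...   | yes P⁺ | no ¬Q⁺ = S ∪ ⁅ x ⁆ , p⊆p∪q ⁅ x ⁆ , inj₁ (P⁺ , ¬Q⁺)
    ...   | no ¬P⁺ | yes Q⁺ = S ∪ ⁅ x ⁆ , p⊆p∪q ⁅ x ⁆ , inj₂ (¬P⁺ , Q⁺)
    ...   | no ¬P⁺ | no ¬Q⁺ =
      let S′ , S∪x⊆S′ , differ = go (S ∪ ⁅ x ⁆) (larger (x∉p⇒p⊂p∪⁅x⁆ (x∈∁p⇒x∉p x∈∁S))) ¬P⁺ ¬Q⁺
      in  S′ , ⊆-trans (p⊆p∪q ⁅ x ⁆) S∪x⊆S′ , differ

-- The functions tabulated in Lset and Rset are local to Defs; lookup∘tabulate recovers them by unification.
lookup-Lset : ∀ n₁ n₂ (i : Fin (n₁ + n₂)) →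
              lookup (Lset n₁ n₂) i ≡ [ const inside , const outside ]′ (splitAt n₁ i)
lookup-Lset n₁ n₂ i with splitAt n₁ i | (lookup (Lset n₁ n₂) i ≡ _ ∋ lookup∘tabulate _ i)
... | inj₁ _ | lookup≡ = lookup≡
... | inj₂ _ | lookup≡ = lookup≡

lookup-Rset : ∀ n₁ n₂ (i : Fin (n₁ + n₂)) →
              lookup (Rset n₁ n₂) i ≡ [ const outside , const inside ]′ (splitAt n₁ i)
lookup-Rset n₁ n₂ i with splitAt n₁ i | (lookup (Rset n₁ n₂) i ≡ _ ∋ lookup∘tabulate _ i)
... | inj₁ _ | lookup≡ = lookup≡
... | inj₂ _ | lookup≡ = lookup≡

Lset≡⊤++⊥ : ∀ n₁ n₂ → Lset n₁ n₂ ≡ ⊤ {n₁} ++ ⊥ {n₂}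
Lset≡⊤++⊥ n₁ n₂ = lookup-≗⇒≡ λ i → begin
  lookup (Lset n₁ n₂) i                            ≡⟨ lookup-Lset n₁ n₂ i ⟩
  [ const inside , const outside ]′ (splitAt n₁ i) ≡⟨ [,]-cong (λ j → sym (lookup-replicate j inside))
                                                                (λ j → sym (lookup-replicate j outside))
                                                                (splitAt n₁ i) ⟩
  [ lookup ⊤ , lookup ⊥ ]′ (splitAt n₁ i)          ≡⟨ lookup-splitAt n₁ ⊤ ⊥ i ⟨
  lookup (⊤ {n₁} ++ ⊥ {n₂}) i                      ∎
  where open ≡-Reasoning

Rset≡∁Lset : ∀ n₁ n₂ → Rset n₁ n₂ ≡ ∁ (Lset n₁ n₂)
Rset≡∁Lset n₁ n₂ = lookup-≗⇒≡ λ i → begin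
  lookup (Rset n₁ n₂) i                                  ≡⟨ lookup-Rset n₁ n₂ i ⟩
  [ const outside , const inside ]′ (splitAt n₁ i)       ≡⟨ [,]-∘ not (splitAt n₁ i) ⟨
  not ([ const inside , const outside ]′ (splitAt n₁ i)) ≡⟨ cong not (lookup-Lset n₁ n₂ i) ⟨
  not (lookup (Lset n₁ n₂) i)                            ≡⟨ lookup-map i not (Lset n₁ n₂) ⟨
  lookup (∁ (Lset n₁ n₂)) i                              ∎
  where open ≡-Reasoning

∣Lset∣≡n₁ : ∀ n₁ n₂ → ∣ Lset n₁ n₂ ∣ ≡ n₁
∣Lset∣≡n₁ n₁ n₂ = begin
  ∣ Lset n₁ n₂ ∣               ≡⟨ cong ∣_∣ (Lset≡⊤++⊥ n₁ n₂) ⟩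
  ∣ ⊤ {n₁} ++ ⊥ {n₂} ∣         ≡⟨ ∣p++q∣≡∣p∣+∣q∣ (⊤ {n₁}) (⊥ {n₂}) ⟩
  ∣ ⊤ {n₁} ∣ + ∣ ⊥ {n₂} ∣      ≡⟨ cong₂ _+_ (∣⊤∣≡n n₁) (∣⊥∣≡0 n₂) ⟩
  n₁ + 0                       ≡⟨ +-identityʳ n₁ ⟩
  n₁                           ∎
  where open ≡-Reasoning

∣Rset∣≡n₂ : ∀ n₁ n₂ → ∣ Rset n₁ n₂ ∣ ≡ n₂
∣Rset∣≡n₂ n₁ n₂ = begin
  ∣ Rset n₁ n₂ ∣           ≡⟨ cong ∣_∣ (Rset≡∁Lset n₁ n₂) ⟩
  ∣ ∁ (Lset n₁ n₂) ∣       ≡⟨ ∣∁p∣≡n∸∣p∣ (Lset n₁ n₂) ⟩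
  n₁ + n₂ ∸ ∣ Lset n₁ n₂ ∣ ≡⟨ cong (n₁ + n₂ ∸_) (∣Lset∣≡n₁ n₁ n₂) ⟩
  n₁ + n₂ ∸ n₁             ≡⟨ m+n∸m≡n n₁ n₂ ⟩
  n₂                       ∎
  where open ≡-Reasoning

Lset-or-Rset : ∀ n₁ n₂ (i : Fin (n₁ + n₂)) →
               i ∈ Lset n₁ n₂ × i ∉ Rset n₁ n₂ ⊎ i ∉ Lset n₁ n₂ × i ∈ Rset n₁ n₂
Lset-or-Rset n₁ n₂ i rewrite Rset≡∁Lset n₁ n₂ with i ∈? Lset n₁ n₂
... | yes i∈L = inj₁ (i∈L , x∈p⇒x∉∁p i∈L)
... | no  i∉L = inj₂ (i∉L , x∉p⇒x∈∁p i∉L)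

m∸n≤o⇒m∸o≤n : ∀ m n o → m ∸ n ≤ o → m ∸ o ≤ n
m∸n≤o⇒m∸o≤n m n o m∸n≤o = m≤n+o⇒m∸n≤o m o (begin
  m           ≤⟨ m≤n+m∸n m n ⟩
  n + (m ∸ n) ≤⟨ +-monoʳ-≤ n m∸n≤o ⟩
  n + o       ≡⟨ +-comm n o ⟩
  o + n       ∎)
  where open ≤-Reasoning

x∈p⇒y∈q⇒x≢y : ∀ {n} {p q : Subset n} {x y : Fin n} → Empty (p ∩ q) → x ∈ p → y ∈ q → x ≢ y
x∈p⇒y∈q⇒x≢y p∩q-empty x∈p y∈q refl = p∩q-empty (_ , x∈p∩q⁺ (x∈p , y∈q))

-- Fall n₁ n₂ k J S unfolds to FallsAt k J ∣ S ∩ Lset n₁ n₂ ∣ ∣ S ∩ Rset n₁ n₂ ∣.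
FallsAt : (k : ℕ) → Subset (suc k) → ℕ → ℕ → Set
FallsAt k J a b = ∃[ j ] (j ∈ J × toℕ j ≤ a × k ∸ toℕ j ≤ b)

module _ {k : ℕ} where

  feasible⇒FallsAt : ∀ {n₁ n₂} {J : Subset (suc k)} → FeasibleSet n₁ n₂ k J → FallsAt k J n₁ n₂
  feasible⇒FallsAt {n₁} {n₂} ((j , j∈J) , feasible) =
    let k∸n₂≤j , j≤k⊓n₁ = feasible j∈J
    in  j , j∈J , m≤n⊓o⇒m≤o k n₁ j≤k⊓n₁ , m∸n≤o⇒m∸o≤n k n₂ (toℕ j) k∸n₂≤j

  module _ {J : Subset (suc k)} {a b : ℕ} (¬falls : ¬ FallsAt k J a b) {j : Fin (suc k)} (j∈J : j ∈ J) where

    new-witness-sucˡ : toℕ j ≤ suc a → k ∸ toℕ j ≤ b → toℕ j ≡ suc a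
    new-witness-sucˡ j≤1+a k∸j≤b = ≤-antisym j≤1+a (≰⇒> λ j≤a → ¬falls (j , j∈J , j≤a , k∸j≤b))

    new-witness-sucʳ : toℕ j ≤ a → k ∸ toℕ j ≤ suc b → k ∸ toℕ j ≡ suc b
    new-witness-sucʳ j≤a k∸j≤1+b = ≤-antisym k∸j≤1+b (≰⇒> λ k∸j≤b → ¬falls (j , j∈J , j≤a , k∸j≤b))

  module _ {J₁ J₂ : Subset (suc k)} (disjoint : Empty (J₁ ∩ J₂)) {a b : ℕ}
           (¬falls₁ : ¬ FallsAt k J₁ a b) (¬falls₂ : ¬ FallsAt k J₂ a b) where

    ¬both-FallsAt-sucˡ : ¬ (FallsAt k J₁ (suc a) b × FallsAt k J₂ (suc a) b)
    ¬both-FallsAt-sucˡ ((j₁ , j₁∈J₁ , l₁ , r₁) , (j₂ , j₂∈J₂ , l₂ , r₂)) =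
      x∈p⇒y∈q⇒x≢y disjoint j₁∈J₁ j₂∈J₂ (toℕ-injective (trans
        (new-witness-sucˡ ¬falls₁ j₁∈J₁ l₁ r₁) (sym (new-witness-sucˡ ¬falls₂ j₂∈J₂ l₂ r₂))))

    ¬both-FallsAt-sucʳ : ¬ (FallsAt k J₁ a (suc b) × FallsAt k J₂ a (suc b))
    ¬both-FallsAt-sucʳ ((j₁ , j₁∈J₁ , l₁ , r₁) , (j₂ , j₂∈J₂ , l₂ , r₂)) =
      x∈p⇒y∈q⇒x≢y disjoint j₁∈J₁ j₂∈J₂ (toℕ-injective (∸-cancelˡ-≡ (toℕ≤pred[n] j₁) (toℕ≤pred[n] j₂)
        (trans (new-witness-sucʳ ¬falls₁ j₁∈J₁ l₁ r₁) (sym (new-witness-sucʳ ¬falls₂ j₂∈J₂ l₂ r₂)))))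

module _ (n₁ n₂ k : ℕ) where

  private
    L R : Subset (n₁ + n₂)
    L = Lset n₁ n₂
    R = Rset n₁ n₂

  Fall-⊤ : ∀ {J} → FeasibleSet n₁ n₂ k J → Fall n₁ n₂ k J ⊤
  Fall-⊤ {J} feasible = subst₂ (FallsAt k J)
    (sym (trans (cong ∣_∣ (∩-identityˡ L)) (∣Lset∣≡n₁ n₁ n₂)))
    (sym (trans (cong ∣_∣ (∩-identityˡ R)) (∣Rset∣≡n₂ n₁ n₂)))
    (feasible⇒FallsAt feasible)

  ¬both-Fall-∪⁅x⁆ : ∀ {J₁ J₂} → Empty (J₁ ∩ J₂) → ∀ {S x} → x ∉ S →
                    ¬ Fall n₁ n₂ k J₁ S → ¬ Fall n₁ n₂ k J₂ S →
                    ¬ (Fall n₁ n₂ k J₁ (S ∪ ⁅ x ⁆) × Fall n₁ n₂ k J₂ (S ∪ ⁅ x ⁆))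
  ¬both-Fall-∪⁅x⁆ disjoint {S} {x} x∉S ¬falls₁ ¬falls₂ (falls₁ , falls₂) with Lset-or-Rset n₁ n₂ x
  ... | inj₁ (x∈L , x∉R) = ¬both-FallsAt-sucˡ disjoint ¬falls₁ ¬falls₂ (grow falls₁ , grow falls₂)
    where
    grow : ∀ {J} → Fall n₁ n₂ k J (S ∪ ⁅ x ⁆) → FallsAt k J (suc ∣ S ∩ L ∣) ∣ S ∩ R ∣
    grow {J} = subst₂ (FallsAt k J) (∣p∪⁅x⁆∩q∣≡1+∣p∩q∣ S L x∉S x∈L) (∣p∪⁅x⁆∩q∣≡∣p∩q∣ S R x∉R)
  ... | inj₂ (x∉L , x∈R) = ¬both-FallsAt-sucʳ disjoint ¬falls₁ ¬falls₂ (grow falls₁ , grow falls₂)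
    where
    grow : ∀ {J} → Fall n₁ n₂ k J (S ∪ ⁅ x ⁆) → FallsAt k J ∣ S ∩ L ∣ (suc ∣ S ∩ R ∣)
    grow {J} = subst₂ (FallsAt k J) (∣p∪⁅x⁆∩q∣≡∣p∩q∣ S L x∉L) (∣p∪⁅x⁆∩q∣≡1+∣p∩q∣ S R x∉S x∈R)

  Fall⇒f≡fall : ∀ J S → Fall n₁ n₂ k J S → f n₁ n₂ k J S ≡ fall
  Fall⇒f≡fall J S falls with Fall? n₁ n₂ k J S
  ... | yes _     = refl
  ... | no ¬falls = contradiction falls ¬falls

  ¬Fall⇒f≡hang : ∀ J S → ¬ Fall n₁ n₂ k J S → f n₁ n₂ k J S ≡ hang
  ¬Fall⇒f≡hang J S ¬falls with Fall? n₁ n₂ k J S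
  ... | yes falls = contradiction falls ¬falls
  ... | no _      = refl

  f≡hang⇒¬Fall : ∀ J S → f n₁ n₂ k J S ≡ hang → ¬ Fall n₁ n₂ k J S
  f≡hang⇒¬Fall J S f≡hang falls with () ← trans (sym (Fall⇒f≡fall J S falls)) f≡hang

  f-≢ : ∀ J₁ J₂ S →
        Fall n₁ n₂ k J₁ S × ¬ Fall n₁ n₂ k J₂ S ⊎ ¬ Fall n₁ n₂ k J₁ S × Fall n₁ n₂ k J₂ S →
        f n₁ n₂ k J₁ S ≢ f n₁ n₂ k J₂ S
  f-≢ J₁ J₂ S (inj₁ (falls₁ , ¬falls₂)) f₁≡f₂
    with () ← trans (sym (Fall⇒f≡fall J₁ S falls₁)) (trans f₁≡f₂ (¬Fall⇒f≡hang J₂ S ¬falls₂))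
  f-≢ J₁ J₂ S (inj₂ (¬falls₁ , falls₂)) f₁≡f₂
    with () ← trans (sym (Fall⇒f≡fall J₂ S falls₂)) (trans (sym f₁≡f₂) (¬Fall⇒f≡hang J₁ S ¬falls₁))

lemma3p4 : (n₁ n₂ k : ℕ) → 1 ≤ n₁ → 1 ≤ n₂ → 1 ≤ k → k ≤ n₁ + n₂ →
    (J₁ J₂ : Subset (suc k)) →
    FeasibleSet n₁ n₂ k J₁ → FeasibleSet n₁ n₂ k J₂ → Empty (J₁ ∩ J₂) →
    (S : Subset (n₁ + n₂)) →
    f n₁ n₂ k J₁ S ≡ hang → f n₁ n₂ k J₂ S ≡ hang →
    ∃[ S′ ] (S ⊆ S′ × f n₁ n₂ k J₁ S′ ≢ f n₁ n₂ k J₂ S′)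
lemma3p4 n₁ n₂ k _ _ _ _ J₁ J₂ feasible₁ _ disjoint S f₁≡hang f₂≡hang
  with separated-above (Fall? n₁ n₂ k J₁) (Fall? n₁ n₂ k J₂)
         (Fall-⊤ n₁ n₂ k feasible₁) (¬both-Fall-∪⁅x⁆ n₁ n₂ k disjoint)
         S (f≡hang⇒¬Fall n₁ n₂ k J₁ S f₁≡hang) (f≡hang⇒¬Fall n₁ n₂ k J₂ S f₂≡hang)
... | S′ , S⊆S′ , differ = S′ , S⊆S′ , f-≢ n₁ n₂ k J₁ J₂ S′ differ
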